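{- For every $N\ge0$ there is a weight-preserving bijection between the disjoint union $\bigsqcup_{n=0}^{N}\mathfrak R^*_{N,n}\times\mathfrak B^*_n$ and $\mathfrak P_N$, where the weight of a pair is the product of the weights of its two components.
   Context: Let $\tilde\alpha=(1-q)\frac1\alpha-1$, $\tilde\beta=(1-q)\frac1\beta-1$. All sets below consist of weighted Motzkin paths (steps $\nearrow,\rightarrow,\searrow$ from height 0 to 0, never below 0), where each step carries one of its allowed weights, different weight choices give different elements, and the weight of a path is the product of its step weights. $\mathfrak P_N$: paths of length $N$ where a step $\nearrow$ starting at height $h$ has weight $q^i-q^{i+1}$ for some $i\in\{0,\dots,h\}$, a step $\rightarrow$ starting at height $h$ has weight $1+y$ or $(\tilde\alpha+y\tilde\beta)q^h$, and a step $\searrow$ starting at height $h$ has weight $y$ or $-y\tilde\alpha\tilde\beta q^{h-1}$. $\mathfrak R^*_{N,n}$: paths of length $N$ where a step $\nearrow$ starting at height $h$ has weight $q^i-q^{i+1}$ for some $i\in\{0,\dots,h\}$, a step $\rightarrow$ starting at height $h$ has weight $1+y$ or $q^h$, a step $\searrow$ has weight $y$, and exactly $n$ steps $\rightarrow$ have weight $q^h$. $\mathfrak B^*_n$: paths of length $n$ where a step $\nearrow$ starting at height $h$ has weight $q^i-q^{i+1}$ for some $i\in\{0,\dots,h\}$, a step $\rightarrow$ starting at height $h$ has weight $(\tilde\alpha+y\tilde\beta)q^h$, and a step $\searrow$ starting at height $h$ has weight $-y\tilde\alpha\tilde\beta q^{h-1}$. -}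

module Defs where

open import Level using (Level)
open import Algebra.Bundles using (CommutativeRing)
open import Data.Nat using (ℕ; zero; suc)
open import Data.Fin using (Fin; toℕ)
open import Data.Product using (Σ; _×_; _,_)

-- Weighted Motzkin paths, encoded with explicit weight choices.
-- An inhabitant of `PPath n h` is a path of length n starting at height h
-- and ending at height 0, never going below 0 (heights are natural numbers).

-- Paths of 𝔓: up-steps choose i ∈ {0..h}; flat steps choose weight
-- 1+y (flat₁) or (α̃+yβ̃)q^h (flatq); down-steps choose y (down₁) or
-- -yα̃β̃ q^{h-1} (downq).
data PPath : ℕ → ℕ → Set where
  end   : PPath 0 0
  up    : ∀ {n h} → Fin (suc h) → PPath n (suc h) → PPath (suc n) h
  flat₁ : ∀ {n h} → PPath n h → PPath (suc n) h
  flatq : ∀ {n h} → PPath n h → PPath (suc n) h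
  down₁ : ∀ {n h} → PPath n h → PPath (suc n) (suc h)
  downq : ∀ {n h} → PPath n h → PPath (suc n) (suc h)

-- Paths of 𝔑*: `RPath n h k` = length n, from height h to 0, with exactly
-- k flat steps of weight q^h (flatq); other flats have weight 1+y,
-- down steps weight y.
data RPath : ℕ → ℕ → ℕ → Set where
  end   : RPath 0 0 0
  up    : ∀ {n h k} → Fin (suc h) → RPath n (suc h) k → RPath (suc n) h k
  flat₁ : ∀ {n h k} → RPath n h k → RPath (suc n) h k
  flatq : ∀ {n h k} → RPath n h k → RPath (suc n) h (suc k)
  down  : ∀ {n h k} → RPath n h k → RPath (suc n) (suc h) k

data BPath : ℕ → ℕ → Set where
  end   : BPath 0 0
  up    : ∀ {n h} → Fin (suc h) → BPath n (suc h) → BPath (suc n) h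
  flat  : ∀ {n h} → BPath n h → BPath (suc n) h
  down  : ∀ {n h} → BPath n h → BPath (suc n) (suc h)

RB : ℕ → Set
RB N = Σ (Fin (suc N)) λ n → RPath N 0 (toℕ n) × BPath (toℕ n) 0

module Weights {c ℓ : Level} (R : CommutativeRing c ℓ)
  (q αinv βinv y : CommutativeRing.Carrier R) where
  open CommutativeRing R

  pow : Carrier → ℕ → Carrier
  pow x zero    = 1#
  pow x (suc k) = x * pow x k

  α̃ : Carrier
  α̃ = (1# + - q) * αinv + - 1#

  β̃ : Carrier
  β̃ = (1# + - q) * βinv + - 1#

  upW : ℕ → Carrier
  upW i = pow q i + - pow q (suc i)

  wP : ∀ {n h} → PPath n h → Carrier
  wP end = 1#
  wP (up i p) = upW (toℕ i) * wP p
  wP (flat₁ p) = (1# + y) * wP p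
  wP {h = h} (flatq p) = ((α̃ + y * β̃) * pow q h) * wP p
  wP (down₁ p) = y * wP p
  wP {h = suc h} (downq p) = (- (y * α̃ * β̃) * pow q h) * wP p

  wR : ∀ {n h k} → RPath n h k → Carrier
  wR end = 1#
  wR (up i p) = upW (toℕ i) * wR p
  wR (flat₁ p) = (1# + y) * wR p
  wR {h = h} (flatq p) = pow q h * wR p
  wR (down p) = y * wR p

  wB : ∀ {n h} → BPath n h → Carrier
  wB end = 1#
  wB (up i p) = upW (toℕ i) * wB p
  wB {h = h} (flat p) = ((α̃ + y * β̃) * pow q h) * wB p
  wB {h = suc h} (down p) = (- (y * α̃ * β̃) * pow q h) * wB p

  wRB : ∀ {N} → RB N → Carrier
  wRB (n , r , b) = wR r * wB b

module Submission where

-- A pair (r , s) ∈ 𝔑*_{N,n} × 𝔅*_n is walked simultaneously: s advances exactly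
-- at the flat steps of weight q^a of r, and the two together form a 𝔓-path of
-- height h = a + b, where a and b are the current heights of r and s.  A flat or
-- down step of s at height b then gets the factor q^(a+b) = q^a · q^b it needs in 𝔓,
-- and steps 1+y, y of r are kept as they are.  An up step of 𝔓 with label
-- i ∈ {0..h} is split at the height a′ of r after the step: i < a′ is an up step of
-- r with label i, and i = a′ + j an up step of s with label j (paired with a flat
-- step of r), as q^i - q^(i+1) = q^a′ (q^j - q^(j+1)).  Reading a 𝔓-path from its
-- end, this decomposition is forced, which gives the inverse.

open import Defs
open import Level using (Level)
open import Algebra.Bundles using (CommutativeRing)
open import Data.Empty using (⊥-elim)
open import Data.Fin using (Fin; toℕ; fromℕ<; cast; _↑ˡ_; _↑ʳ_; splitAt; join)
open import Data.Fin.Properties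
  using (toℕ-fromℕ<; fromℕ<-toℕ; toℕ-cast; cast-involutive; toℕ-↑ˡ; toℕ-↑ʳ; splitAt-join; join-splitAt)
open import Data.Nat using (ℕ; zero; suc; _+_; _≤_; _<_; s≤s; z≤n)
open import Data.Nat.Properties using (suc-injective; +-suc; m≤n⇒m≤1+n; 1+n≢0; m+1+n≢0)
open import Data.Product using (Σ; _×_; _,_; proj₁; proj₂; map; map₁)
open import Data.Sum using (_⊎_; inj₁; inj₂; [_,_]′)
open import Function using (_∘_)
open import Function.Bundles using (_↔_; Inverse; mk↔ₛ′)
open import Function.Construct.Composition using (_↔-∘_)
open import Relation.Binary.PropositionalEquality using (_≡_; refl; sym; trans; cong; module ≡-Reasoning)

-- Interleaving n a b k h: an 𝔑*-path of length n from height a with k flat steps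
-- of weight q^height, interleaved with a 𝔅*-path of length k from height b; h = a + b.
data Interleaving : ℕ → ℕ → ℕ → ℕ → ℕ → Set where
  end    : Interleaving 0 0 0 0 0
  up-R   : ∀ {n a b k h} → Fin (suc a) → Interleaving n (suc a) b k (suc h) → Interleaving (suc n) a b k h
  up-B   : ∀ {n a b k h} → Fin (suc b) → Interleaving n a (suc b) k (suc h) → Interleaving (suc n) a b (suc k) h
  flat-R : ∀ {n a b k h} → Interleaving n a b k h → Interleaving (suc n) a b k h
  flat-B : ∀ {n a b k h} → Interleaving n a b k h → Interleaving (suc n) a b (suc k) h
  down-R : ∀ {n a b k h} → Interleaving n a b k h → Interleaving (suc n) (suc a) b k (suc h)
  down-B : ∀ {n a b k h} → Interleaving n a b k h → Interleaving (suc n) a (suc b) (suc k) (suc h)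

height-sum : ∀ {n a b k h} → Interleaving n a b k h → a + b ≡ h
height-sum end          = refl
height-sum (up-R i t)   = suc-injective (height-sum t)
height-sum {a = a} {b} (up-B j t) = suc-injective (trans (sym (+-suc a b)) (height-sum t))
height-sum (flat-R t)   = height-sum t
height-sum (flat-B t)   = height-sum t
height-sum (down-R t)   = cong suc (height-sum t)
height-sum {a = a} {suc b} (down-B t) = trans (+-suc a b) (cong suc (height-sum t))

erase : ∀ {n a b k h} → Interleaving n a b k h → PPath n h
erase end                  = end
erase {b = b} (up-R i t)   = up (cast (height-sum t) (i ↑ˡ b)) (erase t)
erase {a = a} (up-B j t)   = up (cast (height-sum t) (a ↑ʳ j)) (erase t)
erase (flat-R t)           = flat₁ (erase t)
erase (flat-B t)           = flatq (erase t)
erase (down-R t)           = down₁ (erase t)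
erase (down-B t)           = downq (erase t)

Interleaved : ℕ → ℕ → Set
Interleaved n h = Σ ℕ λ a → Σ ℕ λ b → Σ ℕ λ k → Interleaving n a b k h

toPPath : ∀ {n h} → Interleaved n h → PPath n h
toPPath (_ , _ , _ , t) = erase t

prependUp-R : ∀ {n a b k h} → Interleaving n a b k (suc h) → Fin a → Interleaved (suc n) h
prependUp-R {a = suc a} t i = a , _ , _ , up-R i t

prependUp-B : ∀ {n a b k h} → Interleaving n a b k (suc h) → Fin b → Interleaved (suc n) h
prependUp-B {b = suc b} t j = _ , b , _ , up-B j t

prependUp : ∀ {n a b k h} → Interleaving n a b k (suc h) → Fin a ⊎ Fin b → Interleaved (suc n) h
prependUp t = [ prependUp-R t , prependUp-B t ]′

consUp : ∀ {n h} → Fin (suc h) → Interleaved n (suc h) → Interleaved (suc n) h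
consUp i (a , b , k , t) = prependUp t (splitAt a (cast (sym (height-sum t)) i))

fromPPath : ∀ {n h} → PPath n h → Interleaved n h
fromPPath end       = 0 , 0 , 0 , end
fromPPath (up i p)  = consUp i (fromPPath p)
fromPPath (flat₁ p) = let a , b , k , t = fromPPath p in a , b , k , flat-R t
fromPPath (flatq p) = let a , b , k , t = fromPPath p in a , b , suc k , flat-B t
fromPPath (down₁ p) = let a , b , k , t = fromPPath p in suc a , b , k , down-R t
fromPPath (downq p) = let a , b , k , t = fromPPath p in a , suc b , suc k , down-B t

toPPath-prependUp : ∀ {n a b k h} (t : Interleaving n a b k (suc h)) (s : Fin a ⊎ Fin b) →
  toPPath (prependUp t s) ≡ up (cast (height-sum t) (join a b s)) (erase t)
toPPath-prependUp {a = suc a} t (inj₁ i) = refl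
toPPath-prependUp {b = suc b} t (inj₂ j) = refl

toPPath-consUp : ∀ {n a b k h} (i : Fin (suc h)) (t : Interleaving n a b k (suc h)) →
  toPPath (consUp i (a , b , k , t)) ≡ up i (erase t)
toPPath-consUp {a = a} {b} i t = begin
  toPPath (prependUp t (splitAt a (cast (sym e) i)))
    ≡⟨ toPPath-prependUp t (splitAt a (cast (sym e) i)) ⟩
  up (cast e (join a b (splitAt a (cast (sym e) i)))) (erase t)
    ≡⟨ cong (λ j → up (cast e j) (erase t)) (join-splitAt a b (cast (sym e) i)) ⟩
  up (cast e (cast (sym e) i)) (erase t)
    ≡⟨ cong (λ j → up j (erase t)) (cast-involutive e (sym e) i) ⟩
  up i (erase t) ∎
  where
  open ≡-Reasoning
  e = height-sum t

consUp-join : ∀ {n a b k h} (t : Interleaving n a b k (suc h)) (s : Fin a ⊎ Fin b) →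
  consUp (cast (height-sum t) (join a b s)) (a , b , k , t) ≡ prependUp t s
consUp-join {a = a} {b} t s = cong (prependUp t) (begin
  splitAt a (cast (sym (height-sum t)) (cast (height-sum t) (join a b s)))
    ≡⟨ cong (splitAt a) (cast-involutive (sym (height-sum t)) (height-sum t) (join a b s)) ⟩
  splitAt a (join a b s)
    ≡⟨ splitAt-join a b s ⟩
  s ∎)
  where open ≡-Reasoning

toPPath-fromPPath : ∀ {n h} (p : PPath n h) → toPPath (fromPPath p) ≡ p
toPPath-fromPPath end = refl
toPPath-fromPPath (up i p) with fromPPath p | toPPath-fromPPath p
... | _ , _ , _ , t | refl = toPPath-consUp i t
toPPath-fromPPath (flat₁ p) = cong flat₁ (toPPath-fromPPath p)
toPPath-fromPPath (flatq p) = cong flatq (toPPath-fromPPath p)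
toPPath-fromPPath (down₁ p) = cong down₁ (toPPath-fromPPath p)
toPPath-fromPPath (downq p) = cong downq (toPPath-fromPPath p)

fromPPath-erase : ∀ {n a b k h} (t : Interleaving n a b k h) → fromPPath (erase t) ≡ (a , b , k , t)
fromPPath-erase end        = refl
fromPPath-erase (up-R i t) =
  trans (cong (consUp (cast (height-sum t) (i ↑ˡ _))) (fromPPath-erase t)) (consUp-join t (inj₁ i))
fromPPath-erase (up-B j t) =
  trans (cong (consUp (cast (height-sum t) (_ ↑ʳ j))) (fromPPath-erase t)) (consUp-join t (inj₂ j))
fromPPath-erase (flat-R t) rewrite fromPPath-erase t = refl
fromPPath-erase (flat-B t) rewrite fromPPath-erase t = refl
fromPPath-erase (down-R t) rewrite fromPPath-erase t = refl
fromPPath-erase (down-B t) rewrite fromPPath-erase t = refl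

Interleaved↔PPath : ∀ {n h} → Interleaved n h ↔ PPath n h
Interleaved↔PPath = mk↔ₛ′ toPPath fromPPath toPPath-fromPPath (λ (_ , _ , _ , t) → fromPPath-erase t)

unzip : ∀ {n a b k h} → Interleaving n a b k h → RPath n a k × BPath k b
unzip end        = end , end
unzip (up-R i t) = map₁ (up i) (unzip t)
unzip (up-B j t) = map flatq (up j) (unzip t)
unzip (flat-R t) = map₁ flat₁ (unzip t)
unzip (flat-B t) = map flatq flat (unzip t)
unzip (down-R t) = map₁ down (unzip t)
unzip (down-B t) = map flatq down (unzip t)

zip : ∀ {n a b k h} → a + b ≡ h → RPath n a k → BPath k b → Interleaving n a b k h
zip e    (up i r)    s         = up-R i (zip (cong suc e) r s)
zip e    (flat₁ r)   s         = flat-R (zip e r s)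
zip {a = a} {b} e (flatq r) (up j s) = up-B j (zip (trans (+-suc a b) (cong suc e)) r s)
zip e    (flatq r)   (flat s)  = flat-B (zip e r s)
zip {a = a} {suc b} {h = zero}  e (flatq r) (down s) = ⊥-elim (m+1+n≢0 a e)
zip {a = a} {suc b} {h = suc h} e (flatq r) (down s) =
  down-B (zip (suc-injective (trans (sym (+-suc a b)) e)) r s)
zip {h = suc h} e (down r) s = down-R (zip (suc-injective e) r s)
zip refl end end = end

unzip-zip : ∀ {n a b k h} (e : a + b ≡ h) (r : RPath n a k) (s : BPath k b) → unzip (zip e r s) ≡ (r , s)
unzip-zip e (up i r) s = cong (map₁ (up i)) (unzip-zip (cong suc e) r s)
unzip-zip e (flat₁ r) s = cong (map₁ flat₁) (unzip-zip e r s)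
unzip-zip {a = a} {b} e (flatq r) (up j s) =
  cong (map flatq (up j)) (unzip-zip (trans (+-suc a b) (cong suc e)) r s)
unzip-zip e (flatq r) (flat s) = cong (map flatq flat) (unzip-zip e r s)
unzip-zip {a = a} {suc b} {h = zero} e (flatq r) (down s) = ⊥-elim (m+1+n≢0 a e)
unzip-zip {a = a} {suc b} {h = suc h} e (flatq r) (down s) =
  cong (map flatq down) (unzip-zip (suc-injective (trans (sym (+-suc a b)) e)) r s)
unzip-zip {h = suc h} e (down r) s = cong (map₁ down) (unzip-zip (suc-injective e) r s)
unzip-zip refl end end = refl

zip-unzip : ∀ {n a b k h} (e : a + b ≡ h) (t : Interleaving n a b k h) →
  zip e (proj₁ (unzip t)) (proj₂ (unzip t)) ≡ t
zip-unzip e (up-R i t) = cong (up-R i) (zip-unzip _ t)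
zip-unzip e (up-B j t) = cong (up-B j) (zip-unzip _ t)
zip-unzip e (flat-R t) = cong flat-R (zip-unzip _ t)
zip-unzip e (flat-B t) = cong flat-B (zip-unzip _ t)
zip-unzip e (down-R t) = cong down-R (zip-unzip _ t)
zip-unzip e (down-B t) = cong down-B (zip-unzip _ t)
zip-unzip refl end = refl

module _ {n : ℕ} (F : ℕ → Set) (bounded : ∀ {k} → F k → k < n) where

  private
    pack : ∀ {k} (i : Fin n) → toℕ i ≡ k → F k → Σ (Fin n) (F ∘ toℕ)
    pack i refl x = i , x

    pack-≡ : ∀ {i j : Fin n} (x : F (toℕ i)) → j ≡ i → (e : toℕ j ≡ toℕ i) → pack j e x ≡ (i , x)
    pack-≡ x refl refl = refl

    to : Σ (Fin n) (F ∘ toℕ) → Σ ℕ F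
    to (i , x) = toℕ i , x

    from : Σ ℕ F → Σ (Fin n) (F ∘ toℕ)
    from (_ , x) = pack (fromℕ< (bounded x)) (toℕ-fromℕ< (bounded x)) x

    to-from : ∀ {k} (i : Fin n) (e : toℕ i ≡ k) (x : F k) → to (pack i e x) ≡ (k , x)
    to-from i refl x = refl

  Σ-Fin↔Σ-ℕ : Σ (Fin n) (F ∘ toℕ) ↔ Σ ℕ F
  Σ-Fin↔Σ-ℕ = mk↔ₛ′ to from
    (λ (_ , x) → to-from _ (toℕ-fromℕ< (bounded x)) x)
    (λ (i , x) → pack-≡ x (fromℕ<-toℕ i (bounded x)) (toℕ-fromℕ< (bounded x)))

k≤n : ∀ {n h k} → RPath n h k → k ≤ n
k≤n end       = z≤n
k≤n (up i r)  = m≤n⇒m≤1+n (k≤n r)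
k≤n (flat₁ r) = m≤n⇒m≤1+n (k≤n r)
k≤n (flatq r) = s≤s (k≤n r)
k≤n (down r)  = m≤n⇒m≤1+n (k≤n r)

Grounded : ℕ → Set
Grounded n = Σ ℕ λ k → RPath n 0 k × BPath k 0

Grounded↔Interleaved : ∀ {n} → Grounded n ↔ Interleaved n 0
Grounded↔Interleaved = mk↔ₛ′ to from to-from (λ (k , r , s) → cong (k ,_) (unzip-zip refl r s))
  where
  to : ∀ {n} → Grounded n → Interleaved n 0
  to (k , r , s) = 0 , 0 , k , zip refl r s

  from : ∀ {n} → Interleaved n 0 → Grounded n
  from (zero  , zero  , k , t) = k , unzip t
  from (zero  , suc b , k , t) = ⊥-elim (1+n≢0 (height-sum t))
  from (suc a , b     , k , t) = ⊥-elim (1+n≢0 (height-sum t))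

  to-from : ∀ {n} (t : Interleaved n 0) → to (from t) ≡ t
  to-from (zero  , zero  , k , t) = cong (λ t → 0 , 0 , k , t) (zip-unzip refl t)
  to-from (zero  , suc b , k , t) = ⊥-elim (1+n≢0 (height-sum t))
  to-from (suc a , b     , k , t) = ⊥-elim (1+n≢0 (height-sum t))

RB↔PPath : ∀ N → RB N ↔ PPath N 0
RB↔PPath N =
  Interleaved↔PPath ↔-∘ (Grounded↔Interleaved ↔-∘ Σ-Fin↔Σ-ℕ (λ k → RPath N 0 k × BPath k 0) (s≤s ∘ k≤n ∘ proj₁))

module InterleavingWeights {c ℓ : Level} (R : CommutativeRing c ℓ)
  (q αinv βinv y : CommutativeRing.Carrier R) where
  open CommutativeRing R
    renaming (_+_ to _⊕_; refl to ≈-refl; sym to ≈-sym; trans to ≈-trans)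
  open Weights R q αinv βinv y
  open import Algebra.Properties.Ring ring using (-‿distribʳ-*)
  open import Algebra.Properties.CommutativeSemigroup *-commutativeSemigroup using (interchange)
  open import Relation.Binary.Reasoning.Setoid setoid

  pow-+ : ∀ x m n → pow x (m + n) ≈ pow x m * pow x n
  pow-+ x zero    n = ≈-sym (*-identityˡ _)
  pow-+ x (suc m) n = begin
    x * pow x (m + n)       ≈⟨ *-congˡ (pow-+ x m n) ⟩
    x * (pow x m * pow x n) ≈⟨ ≈-sym (*-assoc _ _ _) ⟩
    x * pow x m * pow x n   ∎

  upW-+ : ∀ m n → upW (m + n) ≈ pow q m * upW n
  upW-+ m n = begin
    pow q (m + n) ⊕ - pow q (suc (m + n))
      ≈⟨ +-cong (pow-+ q m n) (-‿cong (reflexive (cong (pow q) (sym (+-suc m n))))) ⟩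
    pow q m * pow q n ⊕ - pow q (m + suc n)
      ≈⟨ +-congˡ (-‿cong (pow-+ q m (suc n))) ⟩
    pow q m * pow q n ⊕ - (pow q m * pow q (suc n))
      ≈⟨ +-congˡ (-‿distribʳ-* _ _) ⟩
    pow q m * pow q n ⊕ pow q m * - pow q (suc n)
      ≈⟨ ≈-sym (distribˡ _ _ _) ⟩
    pow q m * upW n ∎

  *-pow-split : ∀ {a b h} x → a + b ≡ h → x * pow q h ≈ pow q a * (x * pow q b)
  *-pow-split {a} {b} x refl = begin
    x * pow q (a + b)       ≈⟨ *-congˡ (pow-+ q a b) ⟩
    x * (pow q a * pow q b) ≈⟨ ≈-sym (*-assoc _ _ _) ⟩
    x * pow q a * pow q b   ≈⟨ *-congʳ (*-comm _ _) ⟩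
    pow q a * x * pow q b   ≈⟨ *-assoc _ _ _ ⟩
    pow q a * (x * pow q b) ∎

  charge-R : ∀ {u v w r s} → u ≈ v → w ≈ r * s → u * w ≈ (v * r) * s
  charge-R u≈v w≈rs = ≈-trans (*-cong u≈v w≈rs) (≈-sym (*-assoc _ _ _))

  charge-RB : ∀ {u v v′ w r s} → u ≈ v * v′ → w ≈ r * s → u * w ≈ (v * r) * (v′ * s)
  charge-RB u≈vv′ w≈rs = ≈-trans (*-cong u≈vv′ w≈rs) (interchange _ _ _ _)

  wP-erase : ∀ {n a b k h} (t : Interleaving n a b k h) →
    wP (erase t) ≈ wR (proj₁ (unzip t)) * wB (proj₂ (unzip t))
  wP-erase end = ≈-sym (*-identityˡ _)
  wP-erase {b = b} (up-R i t) =
    charge-R (reflexive (cong upW (trans (toℕ-cast (height-sum t) (i ↑ˡ b)) (toℕ-↑ˡ i b)))) (wP-erase t)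
  wP-erase {a = a} (up-B j t) =
    charge-RB
      (≈-trans (reflexive (cong upW (trans (toℕ-cast (height-sum t) (a ↑ʳ j)) (toℕ-↑ʳ a j)))) (upW-+ a (toℕ j)))
      (wP-erase t)
  wP-erase (flat-R t) = charge-R ≈-refl (wP-erase t)
  wP-erase {a = a} {b} (flat-B t) = charge-RB (*-pow-split {a} {b} _ (height-sum t)) (wP-erase t)
  wP-erase (down-R t) = charge-R ≈-refl (wP-erase t)
  wP-erase {a = a} {suc b} (down-B t) = charge-RB (*-pow-split {a} {b} _ (height-sum t)) (wP-erase t)

  wP-erase-zip : ∀ {n k} (r : RPath n 0 k) (s : BPath k 0) → wP (erase (zip refl r s)) ≈ wR r * wB s
  wP-erase-zip r s = ≈-trans (wP-erase (zip refl r s))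
    (reflexive (cong (λ (r′ , s′) → wR r′ * wB s′) (unzip-zip refl r s)))

proposition4p6 : ∀ {c ℓ : Level} (R : CommutativeRing c ℓ)
    (q α β αinv βinv y : CommutativeRing.Carrier R) →
    CommutativeRing._≈_ R (CommutativeRing._*_ R α αinv) (CommutativeRing.1# R) →
    CommutativeRing._≈_ R (CommutativeRing._*_ R β βinv) (CommutativeRing.1# R) →
    (N : ℕ) →
    Σ (RB N ↔ PPath N 0) λ f →
      ∀ x → CommutativeRing._≈_ R
              (Weights.wP R q αinv βinv y (Inverse.to f x))
              (Weights.wRB R q αinv βinv y x)
-- α and β enter the weights only through α⁻¹ and β⁻¹.
proposition4p6 R q _ _ αinv βinv y _ _ N =
  RB↔PPath N , λ (_ , r , s) → InterleavingWeights.wP-erase-zip R q αinv βinv y r s
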